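{- For each $k\ge1$ there is a deterministic bottom-up tree automaton $\mathcal{A}^{k\text{ - }\mathsf{stw}}_{\mathsf{edges}}$ with $2^{\mathcal{O}(k|\mathsf{Procs}|)}$ states whose accepted language is the set of binary trees $\tau$ over $\Lambda^k$ such that $\tau$ is a valid $k$-STT and $G_\tau$ satisfies: (1) process edges are not branching (every vertex is the source of at most one $\to$-edge and the target of at most one $\to$-edge) and connect events of the same process; (2) data edges are pairwise disjoint (distinct $\gamma$-edges with $\gamma\in\mathsf{DS}$ share no vertex) and respect the writer/reader constraints (every $d$-edge $(e,f)$ has $e$ on process $\mathsf{Writer}(d)$ and $f$ on process $\mathsf{Reader}(d)$).
   Context: Architecture $(\mathsf{Procs},\mathsf{DS},\mathsf{Writer},\mathsf{Reader})$: finite sets $\mathsf{Procs}$, $\mathsf{DS}$, maps $\mathsf{Writer},\mathsf{Reader}:\mathsf{DS}\to\mathsf{Procs}$; $\Sigma$ a finite alphabet. Graphs have vertices labeled in $\Sigma\times\mathsf{Procs}$ (the second component being the process of the vertex) and edges labeled in $\Gamma=\{\to\}\cup\mathsf{DS}$. For $[k]=\{1,\dots,k\}$, $k$-STTs are $\tau::=(i,a,p)\mid\mathsf{Add}^\gamma_{i,j}\tau\mid\mathsf{Forget}_i\tau\mid\tau\oplus\tau$, denoting $[\![\tau]\!]=(G_\tau,\chi_\tau)$ with $\chi_\tau$ a partial injective coloring $[k]\to$ vertices: $(i,a,p)$ is one vertex labeled $(a,p)$ colored $i$; $\mathsf{Add}^\gamma_{i,j}$ adds the $\gamma$-edge $(\chi(i),\chi(j))$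 if both colors are present (else nothing); $\mathsf{Forget}_i$ removes color $i$; $\oplus$ is disjoint union, defined only if color domains are disjoint. Valid $k$-STT: all $\oplus$ defined. Terms are ordered trees over the alphabet $\Lambda^k$ of these symbols.
   Formalization: $G_\tau$ is a multigraph: each $\mathsf{Add}^\gamma_{i,j}$ whose colours are present adds a new edge occurrence even if that edge already exists, and the non-branching and disjointness conditions count edge occurrences, so re-adding an edge violates them. The statement above fails without it. -}

module Defs where

open import Data.Nat using (ℕ; zero; suc; _+_)
open import Data.Fin using (Fin; _↑ˡ_; _↑ʳ_; splitAt; _≟_)
open import Data.Bool using (Bool)
open import Data.Maybe using (Maybe; just; nothing)
import Data.Maybe as Maybe
open import Data.List using (List; []; _∷_; _++_; length; lookup)
import Data.List as List
open import Data.Product using (Σ; _×_; _,_; proj₁; proj₂)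
open import Data.Sum using (_⊎_; [_,_])
open import Data.Unit using (⊤)
open import Relation.Nullary using (yes; no; ¬_)
open import Relation.Binary.PropositionalEquality using (_≡_; _≢_)

data EdgeLabel (nd : ℕ) : Set where
  procEdge : EdgeLabel nd
  dataEdge : Fin nd → EdgeLabel nd

-- The alphabet Λ^k (Procs = Fin np, DS = Fin nd, Σ = Fin ns, colours [k] = Fin k).
data Sym (np nd ns k : ℕ) : Set where
  vertexSym : Fin k → Fin ns → Fin np → Sym np nd ns k
  addSym    : EdgeLabel nd → Fin k → Fin k → Sym np nd ns k
  forgetSym : Fin k → Sym np nd ns k
  plusSym   : Sym np nd ns k

data BinTree (A : Set) : Set where
  leaf   : A → BinTree A
  unary  : A → BinTree A → BinTree A
  binary : A → BinTree A → BinTree A → BinTree A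

record DBUTA (A : Set) : Set where
  field
    nStates : ℕ
    δ₀      : A → Fin nStates
    δ₁      : A → Fin nStates → Fin nStates
    δ₂      : A → Fin nStates → Fin nStates → Fin nStates
    final   : Fin nStates → Bool

module _ {A : Set} (𝒜 : DBUTA A) where
  open DBUTA 𝒜
  run : BinTree A → Fin nStates
  run (leaf a) = δ₀ a
  run (unary a t) = δ₁ a (run t)
  run (binary a t u) = δ₂ a (run t) (run u)

  accepts : BinTree A → Bool
  accepts t = final (run t)

module Arch (np nd ns : ℕ) (Writer Reader : Fin nd → Fin np) (k : ℕ) where

  data STT : Set where
    vtx    : Fin k → Fin ns → Fin np → STT
    add    : EdgeLabel nd → Fin k → Fin k → STT → STT
    forget : Fin k → STT → STT
    _⊕_    : STT → STT → STT

  toTree : STT → BinTree (Sym np nd ns k)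
  toTree (vtx i a p) = leaf (vertexSym i a p)
  toTree (add γ i j τ) = unary (addSym γ i j) (toTree τ)
  toTree (forget i τ) = unary (forgetSym i) (toTree τ)
  toTree (τ ⊕ σ) = binary plusSym (toTree τ) (toTree σ)

  record Graph : Set where
    field
      size   : ℕ
      label  : Fin size → Fin ns × Fin np
      edges  : List (Fin size × EdgeLabel nd × Fin size)

  open Graph

  Colouring : Graph → Set
  Colouring G = Fin k → Maybe (Fin (size G))

  ColGraph : Set
  ColGraph = Σ Graph Colouring

  mapEdge : {m n : ℕ} → (Fin m → Fin n) → Fin m × EdgeLabel nd × Fin m → Fin n × EdgeLabel nd × Fin n
  mapEdge f (u , γ , v) = f u , γ , f v

  ⟦_⟧ : STT → ColGraph
  ⟦ vtx i a p ⟧ = record { size = 1 ; label = λ _ → a , p ; edges = [] } , χ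
    where
    χ : Fin k → Maybe (Fin 1)
    χ j with j ≟ i
    ... | yes _ = just Fin.zero
    ... | no _  = nothing
  ⟦ add γ i j τ ⟧ with ⟦ τ ⟧
  ... | G , χ with χ i | χ j
  ...   | just u | just v = record G { edges = (u , γ , v) ∷ edges G } , χ
  ...   | _      | _      = G , χ
  ⟦ forget i τ ⟧ with ⟦ τ ⟧
  ... | G , χ = G , χ'
    where
    χ' : Fin k → Maybe (Fin (size G))
    χ' j with j ≟ i
    ... | yes _ = nothing
    ... | no _  = χ j
  ⟦ τ ⊕ σ ⟧ with ⟦ τ ⟧ | ⟦ σ ⟧
  ... | G₁ , χ₁ | G₂ , χ₂ =
    record { size = size G₁ + size G₂
           ; label = λ v → [ label G₁ , label G₂ ] (splitAt (size G₁) v)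
           ; edges = List.map (mapEdge (λ u → u ↑ˡ size G₂)) (edges G₁)
                  ++ List.map (mapEdge (λ v → size G₁ ↑ʳ v)) (edges G₂) } , χ
    where
    χ : Fin k → Maybe (Fin (size G₁ + size G₂))
    χ i with χ₁ i
    ... | just u  = just (u ↑ˡ size G₂)
    ... | nothing = Maybe.map (size G₁ ↑ʳ_) (χ₂ i)

  Valid : STT → Set
  Valid (vtx i a p) = ⊤
  Valid (add γ i j τ) = Valid τ
  Valid (forget i τ) = Valid τ
  Valid (τ ⊕ σ) = Valid τ × Valid σ ×
    (∀ (i : Fin k) → proj₂ ⟦ τ ⟧ i ≡ nothing ⊎ proj₂ ⟦ σ ⟧ i ≡ nothing)

  module _ (G : Graph) where
    proc : Fin (size G) → Fin np
    proc v = proj₂ (label G v)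

    -- edge occurrences are indexed by positions in the edge list
    Pos : Set
    Pos = Fin (length (edges G))

    src : Pos → Fin (size G)
    src x = proj₁ (lookup (edges G) x)

    lbl : Pos → EdgeLabel nd
    lbl x = proj₁ (proj₂ (lookup (edges G) x))

    tgt : Pos → Fin (size G)
    tgt x = proj₂ (proj₂ (lookup (edges G) x))

    ProcNotBranching : Set
    ProcNotBranching = ∀ (x y : Pos) → lbl x ≡ procEdge → lbl y ≡ procEdge →
      (src x ≡ src y → x ≡ y) × (tgt x ≡ tgt y → x ≡ y)

    ProcSameProcess : Set
    ProcSameProcess = ∀ (x : Pos) → lbl x ≡ procEdge → proc (src x) ≡ proc (tgt x)

    DataDisjoint : Set
    DataDisjoint = ∀ (x y : Pos) (d e : Fin nd) → lbl x ≡ dataEdge d → lbl y ≡ dataEdge e →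
      x ≢ y → (src x ≢ src y) × (src x ≢ tgt y) × (tgt x ≢ src y) × (tgt x ≢ tgt y)

    DataWriterReader : Set
    DataWriterReader = ∀ (x : Pos) (d : Fin nd) → lbl x ≡ dataEdge d →
      (proc (src x) ≡ Writer d) × (proc (tgt x) ≡ Reader d)

    GoodGraph : Set
    GoodGraph = ProcNotBranching × ProcSameProcess × DataDisjoint × DataWriterReader

  InLang : BinTree (Sym np nd ns k) → Set
  InLang t = Σ STT λ τ → (toTree τ ≡ t) × Valid τ × GoodGraph (proj₁ ⟦ τ ⟧)

{-# OPTIONS --safe #-}

-- A bottom-up run only needs to remember, for each colour i, what later Add
-- operations can still observe about the vertex χ(i): its process, whether it is
-- already the source of a →-edge, the target of a →-edge, and an endpoint of a data
-- edge. Uncoloured vertices never receive new edges and a disjoint union creates no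
-- new conflicts, so conditions (1)–(2) fail exactly when some Add creates an edge
-- whose endpoint profiles forbid it; since colourings of valid terms are injective,
-- the profiles can be updated colour by colour. The states are therefore a rejecting
-- sink plus, for each colour, an optional profile in Procs × 2³: at most
-- (1 + 8|Procs|)^k + 1 ≤ 2^(4(1 + k|Procs|)) of them. The disjointness of colour
-- domains demanded by ⊕ can be read off the states as well.
module Submission where

open import Defs
open import Data.Nat using (ℕ; _+_; _*_; _^_; _≤_; z≤n; s≤s)
import Data.Nat as ℕ
open import Data.Nat.Properties
  using ( ≤-refl; +-mono-≤; m≤m+n; m≤n*m; *-suc; *-monoʳ-≤; *-comm; ^-monoˡ-≤; ^-*-assoc; m<m*n; m^n≢0
        ; module ≤-Reasoning)
open import Data.Bool using (Bool; true; false; _∧_; _∨_; if_then_else_)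
import Data.Bool as Bool
open import Data.Bool.Properties using (∧-assoc; ∧-identityʳ; ∧-zeroʳ; ∨-assoc; ∨-identityʳ)
open import Data.Bool.ListAction using (any; or)
open import Data.Empty using (⊥-elim)
open import Data.Fin using (Fin; zero; suc; _↑ˡ_; _↑ʳ_; splitAt; _≟_)
open import Data.Fin.Properties
  using ( ∀-cons; ∀-cons-⇔; all?; suc-injective; ↑ˡ-injective; ↑ʳ-injective; splitAt-↑ˡ; splitAt-↑ʳ
        ; *↔×; 2↔Bool)
open import Data.List using (List; []; _∷_; _++_; lookup)
import Data.List as List
open import Data.List.Properties using (map-∘; map-cong; ++-identityʳ)
open import Data.Maybe using (Maybe; just; nothing; is-just; when; _<∣>_; _>>=_; maybe′)
import Data.Maybe as Maybe
open import Data.Maybe.Properties using (just-injective)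
open import Data.Product using (Σ; ∃-syntax; _×_; _,_; proj₁; proj₂; uncurry)
open import Data.Product.Function.NonDependent.Propositional using (_×-⇔_; _×-↪_)
open import Data.Sum using (_⊎_; inj₁; inj₂; [_,_])
import Data.Sum
open import Data.Unit using (⊤; tt)
open import Data.Vec using (Vec; []; _∷_; uncons)
import Data.Vec as Vec
open import Data.Vec.Properties using (lookup∘tabulate; tabulate-cong)
open import Function using (_∘_)
open import Function.Bundles using (_⇔_; _↪_; mk⇔; mk↪; Equivalence; RightInverse)
open import Function.Consequences.Propositional using (strictlyInverseʳ⇒inverseʳ)
open import Function.Construct.Composition using (_↪-∘_)
open import Function.Construct.Identity using (↪-id)
import Function.Properties.Equivalence as ⇔
open import Function.Properties.Inverse using (↔-sym; ↔⇒↪)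
open import Relation.Binary.Definitions using (Symmetric)
open import Relation.Binary.PropositionalEquality
  using (_≡_; refl; sym; trans; cong; cong₂; subst; subst₂; _≢_; _≗_; ≢-sym; module ≡-Reasoning)
open import Relation.Nullary using (Dec; yes; no; does)
open import Relation.Nullary.Decidable using (dec-true; dec-false; decidable-stable; _×-dec_; _⊎-dec_)

private
  variable
    A B : Set
    m n : ℕ

does-true : (a? : Dec A) → does a? ≡ true → A
does-true (yes a) _ = a

does≡true⇔ : (a? : Dec A) → (does a? ≡ true) ⇔ A
does≡true⇔ a? = mk⇔ (does-true a?) (dec-true a?)

∧≡true⇔ : ∀ {a b} → (a ∧ b ≡ true) ⇔ (a ≡ true × b ≡ true)
∧≡true⇔ {true} = mk⇔ (refl ,_) proj₂
∧≡true⇔ {false} = mk⇔ (λ ()) (λ ())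

∨≡false⇔ : ∀ {a b} → (a ∨ b ≡ false) ⇔ (a ≡ false × b ≡ false)
∨≡false⇔ {true} = mk⇔ (λ ()) (λ ())
∨≡false⇔ {false} = mk⇔ (refl ,_) proj₂

_==_ : Fin n → Fin n → Bool
a == b = does (a ≟ b)

==≡false⇔≢ : ∀ {a b : Fin n} → (a == b ≡ false) ⇔ (a ≢ b)
==≡false⇔≢ {a = a} {b} = mk⇔ (λ a==b a≡b → false≢true (trans (sym a==b) (dec-true (a ≟ b) a≡b))) (dec-false (a ≟ b))
  where
  false≢true : false ≢ true
  false≢true ()

==-injective : ∀ {f : Fin m → Fin n} → (∀ {a b} → f a ≡ f b → a ≡ b) → ∀ a b → (f a == f b) ≡ (a == b)
==-injective {f = f} f-inj a b with a ≟ b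
... | yes refl = dec-true (f a ≟ f a) refl
... | no a≢b = dec-false (f a ≟ f b) (a≢b ∘ f-inj)

↑ˡ≢↑ʳ : ∀ (u : Fin m) (v : Fin n) → u ↑ˡ n ≢ m ↑ʳ v
↑ˡ≢↑ʳ {m} {n} u v eq with trans (sym (splitAt-↑ˡ m u n)) (trans (cong (splitAt m) eq) (splitAt-↑ʳ m n v))
... | ()

any-++ : ∀ (p : A → Bool) xs ys → any p (xs ++ ys) ≡ any p xs ∨ any p ys
any-++ p [] ys = refl
any-++ p (x ∷ xs) ys rewrite any-++ p xs ys = sym (∨-assoc (p x) _ _)

any-map : ∀ (p : B → Bool) (f : A → B) xs → any p (List.map f xs) ≡ any (p ∘ f) xs
any-map p f xs = cong or (sym (map-∘ xs))

any-cong : ∀ {p q : A → Bool} → p ≗ q → any p ≗ any q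
any-cong p≗q xs = cong or (map-cong p≗q xs)

any-false : ∀ {p : A → Bool} → (∀ x → p x ≡ false) → ∀ xs → any p xs ≡ false
any-false p≡false [] = refl
any-false p≡false (x ∷ xs) rewrite p≡false x = any-false p≡false xs

any≡false⇔ : ∀ (p : A → Bool) xs → (any p xs ≡ false) ⇔ (∀ i → p (lookup xs i) ≡ false)
any≡false⇔ p [] = mk⇔ (λ _ ()) (λ _ → refl)
any≡false⇔ p (x ∷ xs) = ⇔.trans ∨≡false⇔ (⇔.trans (⇔.refl ×-⇔ any≡false⇔ p xs) ∀-cons-⇔)

Pairwise : (A → A → Set) → List A → Set
Pairwise R xs = ∀ i j → i ≢ j → R (lookup xs i) (lookup xs j)

pairwise-∷⇔ : ∀ {R : A → A → Set} → Symmetric R → ∀ x xs →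
  Pairwise R (x ∷ xs) ⇔ ((∀ j → R x (lookup xs j)) × Pairwise R xs)
pairwise-∷⇔ {R = R} R-sym x xs = mk⇔
  (λ P → (λ j → P zero (suc j) λ ()) , λ i j i≢j → P (suc i) (suc j) (i≢j ∘ suc-injective))
  (uncurry pairwise)
  where
  pairwise : (∀ j → R x (lookup xs j)) → Pairwise R xs → Pairwise R (x ∷ xs)
  pairwise _ _ zero zero 0≢0 = ⊥-elim (0≢0 refl)
  pairwise h _ zero (suc j) _ = h j
  pairwise h _ (suc i) zero _ = R-sym (h i)
  pairwise _ P (suc i) (suc j) i≢j = P i j (i≢j ∘ cong suc)

Disjoint : ∀ {l} → (Fin l → Maybe A) → (Fin l → Maybe B) → Set
Disjoint f g = ∀ i → f i ≡ nothing ⊎ g i ≡ nothing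

InjectiveColouring : ∀ {l} → (Fin l → Maybe (Fin n)) → Set
InjectiveColouring χ = ∀ {a b w} → χ a ≡ just w → χ b ≡ just w → a ≡ b

InjectiveColouring-≗ : ∀ {l} {χ χ′ : Fin l → Maybe (Fin n)} →
  χ ≗ χ′ → InjectiveColouring χ′ → InjectiveColouring χ
InjectiveColouring-≗ χ≗χ′ inj {a} {b} χa χb = inj (trans (sym (χ≗χ′ a)) χa) (trans (sym (χ≗χ′ b)) χb)

==-colour : ∀ {l} {χ : Fin l → Maybe (Fin n)} → InjectiveColouring χ →
  ∀ {i j u v} → χ i ≡ just u → χ j ≡ just v → (i == j) ≡ (u == v)
==-colour χ-inj {i} {j} {u} {v} χi χj with i ≟ j
... | yes refl = sym (dec-true (u ≟ v) (just-injective (trans (sym χi) χj)))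
... | no i≢j = sym (dec-false (u ≟ v) λ { refl → i≢j (χ-inj χi χj) })

forgetColour : ∀ {l} → Fin l → (Fin l → Maybe A) → Fin l → Maybe A
forgetColour i χ j = if j == i then nothing else χ j

forgetColour-injective : ∀ {l} {χ : Fin l → Maybe (Fin n)} i →
  InjectiveColouring χ → InjectiveColouring (forgetColour i χ)
forgetColour-injective {χ = χ} i inj {a} {b} χa χb = inj (kept a χa) (kept b χb)
  where
  kept : ∀ {w} j → forgetColour i χ j ≡ just w → χ j ≡ just w
  kept j eq with j ≟ i
  ... | no _ = eq

joinColours : ∀ {l} → (Fin l → Maybe (Fin m)) → (Fin l → Maybe (Fin n)) → Fin l → Maybe (Fin (m + n))
joinColours {m = m} {n} χ₁ χ₂ i = Maybe.map (_↑ˡ n) (χ₁ i) <∣> Maybe.map (m ↑ʳ_) (χ₂ i)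

private
  ComesFrom : Maybe (Fin m) → Maybe (Fin n) → Fin m ⊎ Fin n → Set
  ComesFrom u? _ (inj₁ u) = u? ≡ just u
  ComesFrom _ v? (inj₂ v) = v? ≡ just v

  join-just : ∀ (u? : Maybe (Fin m)) (v? : Maybe (Fin n)) {w} →
    Maybe.map (_↑ˡ n) u? <∣> Maybe.map (m ↑ʳ_) v? ≡ just w → ComesFrom u? v? (splitAt m w)
  join-just {m} {n} (just u) _ refl rewrite splitAt-↑ˡ m u n = refl
  join-just {m} {n} nothing (just v) refl rewrite splitAt-↑ʳ m n v = refl

-- The side of the union on which w lies determines which of χ₁, χ₂ both colours come from.
joinColours-injective : ∀ {l} {χ₁ : Fin l → Maybe (Fin m)} {χ₂ : Fin l → Maybe (Fin n)} →
  InjectiveColouring χ₁ → InjectiveColouring χ₂ → InjectiveColouring (joinColours χ₁ χ₂)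
joinColours-injective {m = m} {χ₁ = χ₁} {χ₂} χ₁-inj χ₂-inj {a} {b} {w} χa χb
  with splitAt m w | join-just (χ₁ a) (χ₂ a) χa | join-just (χ₁ b) (χ₂ b) χb
... | inj₁ _ | χ₁a | χ₁b = χ₁-inj χ₁a χ₁b
... | inj₂ _ | χ₂a | χ₂b = χ₂-inj χ₂a χ₂b


nothing? : (x : Maybe A) → Dec (x ≡ nothing)
nothing? nothing = yes refl
nothing? (just _) = no λ ()

map≡nothing⇔ : ∀ {f : A → B} {x} → (Maybe.map f x ≡ nothing) ⇔ (x ≡ nothing)
map≡nothing⇔ {x = nothing} = mk⇔ (λ _ → refl) (λ _ → refl)
map≡nothing⇔ {x = just _} = mk⇔ (λ ()) (λ ())

is-just⇒≡just : ∀ {x : Maybe A} → is-just x ≡ true → ∃[ a ] x ≡ just a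
is-just⇒≡just {x = just a} _ = a , refl

>>=≡just⇒ : ∀ (x : Maybe A) {f : A → Maybe B} {b} → (x >>= f) ≡ just b → ∃[ a ] x ≡ just a
>>=≡just⇒ (just a) _ = a , refl

map≡just⇒ : ∀ (x : Maybe A) {f : A → B} {b} → Maybe.map f x ≡ just b → ∃[ a ] x ≡ just a
map≡just⇒ (just a) _ = a , refl

is-just-when : ∀ b (x : A) → is-just (when b x) ≡ b
is-just-when true _ = refl
is-just-when false _ = refl

when≡just⇒ : ∀ b {x y : A} → when b x ≡ just y → b ≡ true × x ≡ y
when≡just⇒ true refl = refl , refl

map-when : ∀ (f : A → B) b x → Maybe.map f (when b x) ≡ when b (f x)
map-when f true _ = refl
map-when f false _ = refl

when->>=-just : ∀ b {x : A} {f} → f x ≡ just x → (when b x >>= f) ≡ when b x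
when->>=-just true fx≡x = fx≡x
when->>=-just false _ = refl

when->>=-when : ∀ a b {x : A} {y : B} {f} → f x ≡ when a y → (when b x >>= f) ≡ when (a ∧ b) y
when->>=-when a true fx≡y rewrite ∧-identityʳ a = fx≡y
when->>=-when a false _ rewrite ∧-zeroʳ a = refl

record DBUTAOn (A S : Set) : Set where
  field
    δ₀    : A → S
    δ₁    : A → S → S
    δ₂    : A → S → S → S
    final : S → Bool

module _ {A S : Set} (𝒜 : DBUTAOn A S) where
  open DBUTAOn 𝒜

  runOn : BinTree A → S
  runOn (leaf a) = δ₀ a
  runOn (unary a t) = δ₁ a (runOn t)
  runOn (binary a t u) = δ₂ a (runOn t) (runOn u)

  acceptsOn : BinTree A → Bool
  acceptsOn t = final (runOn t)

  module _ {m} (code : S ↪ Fin m) where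
    open RightInverse code using (to; from; strictlyInverseʳ)

    encodeStates : DBUTA A
    encodeStates = record
      { nStates = m
      ; δ₀ = to ∘ δ₀
      ; δ₁ = λ a q → to (δ₁ a (from q))
      ; δ₂ = λ a q r → to (δ₂ a (from q) (from r))
      ; final = final ∘ from
      }

    from-run : ∀ t → from (run encodeStates t) ≡ runOn t
    from-run (leaf a) = strictlyInverseʳ (δ₀ a)
    from-run (unary a t) rewrite from-run t = strictlyInverseʳ (δ₁ a (runOn t))
    from-run (binary a t u) rewrite from-run t | from-run u = strictlyInverseʳ (δ₂ a (runOn t) (runOn u))

    accepts-encodeStates : ∀ t → accepts encodeStates t ≡ acceptsOn t
    accepts-encodeStates t = cong final (from-run t)

mk↪ₛ : (f : A → B) (g : B → A) → (∀ x → g (f x) ≡ x) → A ↪ B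
mk↪ₛ f g g∘f = mk↪ {to = f} {from = g} (strictlyInverseʳ⇒inverseʳ f g∘f)

Bool↪2 : Bool ↪ Fin 2
Bool↪2 = ↔⇒↪ (↔-sym 2↔Bool)

×↪* : A ↪ Fin m → B ↪ Fin n → (A × B) ↪ Fin (m * n)
×↪* A↪m B↪n = ↔⇒↪ (↔-sym *↔×) ↪-∘ (A↪m ×-↪ B↪n)

Maybe↪suc : A ↪ Fin m → Maybe A ↪ Fin (ℕ.suc m)
Maybe↪suc A↪m = mk↪ₛ (maybe′ (suc ∘ to) zero) (λ { zero → nothing ; (suc i) → just (from i) })
  λ { nothing → refl ; (just a) → cong just (strictlyInverseʳ a) }
  where open RightInverse A↪m using (to; from; strictlyInverseʳ)

Vec↪^ : A ↪ Fin m → ∀ l → Vec A l ↪ Fin (m ^ l)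
Vec↪^ A↪m ℕ.zero = mk↪ₛ (λ _ → zero) (λ _ → []) λ { [] → refl }
Vec↪^ A↪m (ℕ.suc l) = ×↪* A↪m (Vec↪^ A↪m l) ↪-∘ mk↪ₛ uncons (uncurry _∷_) λ { (_ ∷ _) → refl }

module EdgeConstraints (np nd ns : ℕ) (Writer Reader : Fin nd → Fin np) (k : ℕ) where
  open Arch np nd ns Writer Reader k
  open Graph

  Edge : ℕ → Set
  Edge n = Fin n × EdgeLabel nd × Fin n

  Allowed : EdgeLabel nd → Fin np → Fin np → Set
  Allowed procEdge p q = p ≡ q
  Allowed (dataEdge d) p q = p ≡ Writer d × q ≡ Reader d

  Respects : (Fin n → Fin np) → Edge n → Set
  Respects pr (s , γ , t) = Allowed γ (pr s) (pr t)

  Apart : Edge n → Edge n → Set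
  Apart (s , procEdge , t) (s′ , procEdge , t′) = s ≢ s′ × t ≢ t′
  Apart (s , dataEdge _ , t) (s′ , dataEdge _ , t′) = (s ≢ s′ × s ≢ t′) × (t ≢ s′ × t ≢ t′)
  Apart _ _ = ⊤

  Apart-sym : Symmetric (Apart {n})
  Apart-sym {x = _ , procEdge , _} {_ , procEdge , _} (s≢s′ , t≢t′) = ≢-sym s≢s′ , ≢-sym t≢t′
  Apart-sym {x = _ , procEdge , _} {_ , dataEdge _ , _} _ = tt
  Apart-sym {x = _ , dataEdge _ , _} {_ , procEdge , _} _ = tt
  Apart-sym {x = _ , dataEdge _ , _} {_ , dataEdge _ , _} ((s≢s′ , s≢t′) , (t≢s′ , t≢t′)) =
    (≢-sym s≢s′ , ≢-sym t≢s′) , (≢-sym s≢t′ , ≢-sym t≢t′)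

  Good : (Fin n → Fin np) → List (Edge n) → Set
  Good pr es = (∀ i → Respects pr (lookup es i)) × Pairwise Apart es

  Good-∷⇔ : ∀ (pr : Fin n → Fin np) e es →
    Good pr (e ∷ es) ⇔ ((Respects pr e × ∀ j → Apart e (lookup es j)) × Good pr es)
  Good-∷⇔ pr e es = mk⇔
    (λ (r , a) → let (a₀ , a₊) = Equivalence.to pairwise a in (r zero , a₀) , (r ∘ suc , a₊))
    (λ ((r₀ , a₀) , (r₊ , a₊)) → ∀-cons r₀ r₊ , Equivalence.from pairwise (a₀ , a₊))
    where
    pairwise : Pairwise Apart (e ∷ es) ⇔ ((∀ j → Apart e (lookup es j)) × Pairwise Apart es)
    pairwise = pairwise-∷⇔ Apart-sym e es

  Respects⇔ : ∀ (pr : Fin n → Fin np) (e : Edge n) → let (s , γ , t) = e in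
    Respects pr e ⇔ ((γ ≡ procEdge → pr s ≡ pr t) × (∀ d → γ ≡ dataEdge d → pr s ≡ Writer d × pr t ≡ Reader d))
  Respects⇔ pr (s , procEdge , t) = mk⇔ (λ r → (λ _ → r) , (λ _ ())) (λ (r , _) → r refl)
  Respects⇔ pr (s , dataEdge d , t) = mk⇔ (λ r → (λ ()) , (λ { _ refl → r })) (λ (_ , r) → r d refl)

  Apart⇔ : ∀ (e e′ : Edge n) → let (s , γ , t) = e ; (s′ , γ′ , t′) = e′ in
    Apart e e′ ⇔
      ((γ ≡ procEdge → γ′ ≡ procEdge → s ≢ s′ × t ≢ t′) ×
       (∀ d d′ → γ ≡ dataEdge d → γ′ ≡ dataEdge d′ → s ≢ s′ × s ≢ t′ × t ≢ s′ × t ≢ t′))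
  Apart⇔ (_ , procEdge , _) (_ , procEdge , _) = mk⇔ (λ a → (λ _ _ → a) , (λ _ _ ())) (λ (a , _) → a refl refl)
  Apart⇔ (_ , procEdge , _) (_ , dataEdge _ , _) = mk⇔ (λ _ → (λ _ ()) , (λ _ _ ())) (λ _ → tt)
  Apart⇔ (_ , dataEdge _ , _) (_ , procEdge , _) = mk⇔ (λ _ → (λ ()) , (λ _ _ _ ())) (λ _ → tt)
  Apart⇔ (_ , dataEdge d , _) (_ , dataEdge d′ , _) = mk⇔
    (λ ((a , b) , (c , e)) → (λ ()) , (λ { _ _ refl refl → a , b , c , e }))
    (λ (_ , a) → let (a , b , c , e) = a d d′ refl refl in (a , b) , (c , e))

  GoodGraph⇔Good : ∀ G → GoodGraph G ⇔ Good (proc G) (edges G)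
  GoodGraph⇔Good G = mk⇔ toGood fromGood
    where
    open Equivalence
    e : Pos G → Edge (size G)
    e = lookup (edges G)
    toGood : GoodGraph G → Good (proc G) (edges G)
    toGood (branch , same , disjoint , wr) =
      (λ x → from (Respects⇔ (proc G) (e x)) (same x , wr x)) ,
      (λ x y x≢y → from (Apart⇔ (e x) (e y))
        ( (λ lx ly → x≢y ∘ proj₁ (branch x y lx ly) , x≢y ∘ proj₂ (branch x y lx ly))
        , (λ d d′ lx ly → disjoint x y d d′ lx ly x≢y)))
    fromGood : Good (proc G) (edges G) → GoodGraph G
    fromGood (respects , apart) =
      branch , (proj₁ ∘ allowed) , disjoint , (proj₂ ∘ allowed)
      where
      allowed : ∀ x → (lbl G x ≡ procEdge → proc G (src G x) ≡ proc G (tgt G x)) ×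
        (∀ d → lbl G x ≡ dataEdge d → proc G (src G x) ≡ Writer d × proc G (tgt G x) ≡ Reader d)
      allowed x = to (Respects⇔ (proc G) (e x)) (respects x)
      branch : ProcNotBranching G
      branch x y lx ly =
        (λ eq → decidable-stable (x ≟ y) λ x≢y → proj₁ (procApart x≢y) eq) ,
        (λ eq → decidable-stable (x ≟ y) λ x≢y → proj₂ (procApart x≢y) eq)
        where
        procApart : x ≢ y → src G x ≢ src G y × tgt G x ≢ tgt G y
        procApart x≢y = proj₁ (to (Apart⇔ (e x) (e y)) (apart x y x≢y)) lx ly
      disjoint : DataDisjoint G
      disjoint x y d d′ lx ly x≢y = proj₂ (to (Apart⇔ (e x) (e y)) (apart x y x≢y)) d d′ lx ly

  data Incidence : Set where
    procOut procIn dataEnd : Incidence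

  incidence : Incidence → EdgeLabel nd → Bool → Bool → Bool
  incidence procOut procEdge isSource _ = isSource
  incidence procIn procEdge _ isTarget = isTarget
  incidence dataEnd (dataEdge _) isSource isTarget = isSource ∨ isTarget
  incidence _ _ _ _ = false

  incidence-false : ∀ r γ → incidence r γ false false ≡ false
  incidence-false procOut procEdge = refl
  incidence-false procOut (dataEdge _) = refl
  incidence-false procIn procEdge = refl
  incidence-false procIn (dataEdge _) = refl
  incidence-false dataEnd procEdge = refl
  incidence-false dataEnd (dataEdge _) = refl

  incidentTo : Incidence → Fin n → Edge n → Bool
  incidentTo r w (s , γ , t) = incidence r γ (w == s) (w == t)

  hasEdge : Incidence → List (Edge n) → Fin n → Bool
  hasEdge r es w = any (incidentTo r w) es

  sourceRole targetRole : EdgeLabel nd → Incidence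
  sourceRole procEdge = procOut
  sourceRole (dataEdge _) = dataEnd
  targetRole procEdge = procIn
  targetRole (dataEdge _) = dataEnd

  Apart⇔unincident : ∀ s γ t (e : Edge n) →
    Apart (s , γ , t) e ⇔ (incidentTo (sourceRole γ) s e ≡ false × incidentTo (targetRole γ) t e ≡ false)
  Apart⇔unincident s procEdge t (_ , procEdge , _) = ⇔.sym (==≡false⇔≢ ×-⇔ ==≡false⇔≢)
  Apart⇔unincident s procEdge t (_ , dataEdge _ , _) = mk⇔ (λ _ → refl , refl) (λ _ → tt)
  Apart⇔unincident s (dataEdge _) t (_ , procEdge , _) = mk⇔ (λ _ → refl , refl) (λ _ → tt)
  Apart⇔unincident s (dataEdge _) t (_ , dataEdge _ , _) = ⇔.sym (offEdge ×-⇔ offEdge)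
    where
    offEdge : ∀ {w a b : Fin n} → ((w == a) ∨ (w == b) ≡ false) ⇔ (w ≢ a × w ≢ b)
    offEdge = ⇔.trans ∨≡false⇔ (==≡false⇔≢ ×-⇔ ==≡false⇔≢)

  Profile : Set
  Profile = Fin np × Bool × Bool × Bool

  profile : (Fin n → Fin np) → List (Edge n) → Fin n → Profile
  profile pr es w = pr w , hasEdge procOut es w , hasEdge procIn es w , hasEdge dataEnd es w

  Compatible : EdgeLabel nd → Profile → Profile → Set
  Compatible procEdge (p , out , _ , _) (q , _ , in′ , _) =
    Allowed procEdge p q × out ≡ false × in′ ≡ false
  Compatible (dataEdge d) (p , _ , _ , dat) (q , _ , _ , dat′) =
    Allowed (dataEdge d) p q × dat ≡ false × dat′ ≡ false

  compatible? : ∀ γ P Q → Dec (Compatible γ P Q)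
  compatible? procEdge (p , out , _ , _) (q , _ , in′ , _) =
    p ≟ q ×-dec out Bool.≟ false ×-dec in′ Bool.≟ false
  compatible? (dataEdge d) (p , _ , _ , dat) (q , _ , _ , dat′) =
    (p ≟ Writer d ×-dec q ≟ Reader d) ×-dec dat Bool.≟ false ×-dec dat′ Bool.≟ false

  compatible : EdgeLabel nd → Profile → Profile → Bool
  compatible γ P Q = does (compatible? γ P Q)

  Compatible-profile⇔ : ∀ (pr : Fin n → Fin np) es s γ t →
    Compatible γ (profile pr es s) (profile pr es t) ⇔
      (Respects pr (s , γ , t) × ∀ j → Apart (s , γ , t) (lookup es j))
  Compatible-profile⇔ pr es s γ t = ⇔.trans (byRoles γ) (⇔.refl ×-⇔ unincident)
    where
    open Equivalence
    byRoles : ∀ γ → Compatible γ (profile pr es s) (profile pr es t) ⇔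
      (Respects pr (s , γ , t) × hasEdge (sourceRole γ) es s ≡ false × hasEdge (targetRole γ) es t ≡ false)
    byRoles procEdge = ⇔.refl
    byRoles (dataEdge _) = ⇔.refl
    noEdge : ∀ r w → (hasEdge r es w ≡ false) ⇔ (∀ j → incidentTo r w (lookup es j) ≡ false)
    noEdge r w = any≡false⇔ (incidentTo r w) es
    unincident : (hasEdge (sourceRole γ) es s ≡ false × hasEdge (targetRole γ) es t ≡ false) ⇔
      (∀ j → Apart (s , γ , t) (lookup es j))
    unincident = mk⇔
      (λ (out , in′) j →
        from (Apart⇔unincident s γ t _) (to (noEdge (sourceRole γ) s) out j , to (noEdge (targetRole γ) t) in′ j))
      (λ a → from (noEdge (sourceRole γ) s) (proj₁ ∘ to (Apart⇔unincident s γ t _) ∘ a) ,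
             from (noEdge (targetRole γ) t) (proj₂ ∘ to (Apart⇔unincident s γ t _) ∘ a))

  -- Add prepends edges, so each edge is checked against its endpoints' profiles in the edges added before it.
  good : (Fin n → Fin np) → List (Edge n) → Bool
  good pr [] = true
  good pr ((s , γ , t) ∷ es) = compatible γ (profile pr es s) (profile pr es t) ∧ good pr es

  good⇔Good : ∀ (pr : Fin n → Fin np) es → (good pr es ≡ true) ⇔ Good pr es
  good⇔Good pr [] = mk⇔ (λ _ → (λ ()) , (λ ())) (λ _ → refl)
  good⇔Good pr ((s , γ , t) ∷ es) =
    ⇔.trans ∧≡true⇔
      (⇔.trans (⇔.trans (does≡true⇔ (compatible? γ _ _)) (Compatible-profile⇔ pr es s γ t) ×-⇔ good⇔Good pr es)
        (⇔.sym (Good-∷⇔ pr (s , γ , t) es)))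

  profileᴳ : (G : Graph) → Fin (size G) → Profile
  profileᴳ G = profile (proc G) (edges G)

  goodᴳ : Graph → Bool
  goodᴳ G = good (proc G) (edges G)

  GoodGraph⇔good : ∀ G → GoodGraph G ⇔ (goodᴳ G ≡ true)
  GoodGraph⇔good G = ⇔.trans (GoodGraph⇔Good G) (⇔.sym (good⇔Good (proc G) (edges G)))

  profile-cong : ∀ (pr : Fin m → Fin np) es w (pr′ : Fin n → Fin np) es′ w′ →
    pr w ≡ pr′ w′ → (∀ r → hasEdge r es w ≡ hasEdge r es′ w′) → profile pr es w ≡ profile pr′ es′ w′
  profile-cong _ _ _ _ _ _ p≡p′ h = cong₂ _,_ p≡p′ (cong₂ _,_ (h procOut) (cong₂ _,_ (h procIn) (h dataEnd)))

  hasEdge-map : ∀ {f : Fin m → Fin n} → (∀ {a b} → f a ≡ f b → a ≡ b) → ∀ r es w →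
    hasEdge r (List.map (mapEdge f) es) (f w) ≡ hasEdge r es w
  hasEdge-map f-injective r es w = trans (any-map _ _ es)
    (any-cong (λ (s , γ , t) → cong₂ (incidence r γ) (==-injective f-injective w s) (==-injective f-injective w t)) es)

  hasEdge-map-apart : ∀ {m′} {f : Fin m → Fin n} {g : Fin m′ → Fin n} → (∀ a b → f a ≢ g b) → ∀ r es w →
    hasEdge r (List.map (mapEdge g) es) (f w) ≡ false
  hasEdge-map-apart {f = f} {g} f≢g r es w = trans (any-map _ _ es) (any-false offImage es)
    where
    offImage : ∀ e → incidentTo r (f w) (mapEdge g e) ≡ false
    offImage (s , γ , t) =
      trans (cong₂ (incidence r γ) (dec-false (f w ≟ g s) (f≢g w s)) (dec-false (f w ≟ g t) (f≢g w t)))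
            (incidence-false r γ)

  module Embedded (f : Fin m → Fin n) (f-injective : ∀ {a b} → f a ≡ f b → a ≡ b)
           (pr : Fin n → Fin np) (pr₁ : Fin m → Fin np) (pr∘f : ∀ w → pr (f w) ≡ pr₁ w)
           (Y : List (Edge n)) (Y-avoids : ∀ r w → hasEdge r Y (f w) ≡ false) where

    profile-map-++ : ∀ es w → profile pr (List.map (mapEdge f) es ++ Y) (f w) ≡ profile pr₁ es w
    profile-map-++ es w = profile-cong pr (List.map (mapEdge f) es ++ Y) (f w) pr₁ es w (pr∘f w) λ r →
      trans (any-++ _ (List.map (mapEdge f) es) Y)
            (trans (cong₂ _∨_ (hasEdge-map f-injective r es w) (Y-avoids r w)) (∨-identityʳ _))

    good-map-++ : ∀ es → good pr (List.map (mapEdge f) es ++ Y) ≡ good pr₁ es ∧ good pr Y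
    good-map-++ [] = refl
    good-map-++ ((s , γ , t) ∷ es) =
      trans (cong₂ _∧_ (cong₂ (compatible γ) (profile-map-++ es s) (profile-map-++ es t)) (good-map-++ es))
            (sym (∧-assoc (compatible γ (profile pr₁ es s) (profile pr₁ es t)) (good pr₁ es) (good pr Y)))

  _∪ᴳ_ : Graph → Graph → Graph
  G₁ ∪ᴳ G₂ = record
    { size = size G₁ + size G₂
    ; label = λ v → [ label G₁ , label G₂ ] (splitAt (size G₁) v)
    ; edges = List.map (mapEdge (_↑ˡ size G₂)) (edges G₁) ++ List.map (mapEdge (size G₁ ↑ʳ_)) (edges G₂)
    }

  module _ (G₁ G₂ : Graph) where
    private
      n₁ n₂ : ℕ
      n₁ = size G₁
      n₂ = size G₂

    proc-↑ˡ : ∀ u → proc (G₁ ∪ᴳ G₂) (u ↑ˡ n₂) ≡ proc G₁ u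
    proc-↑ˡ u = cong (proj₂ ∘ [ label G₁ , label G₂ ]) (splitAt-↑ˡ n₁ u n₂)

    proc-↑ʳ : ∀ v → proc (G₁ ∪ᴳ G₂) (n₁ ↑ʳ v) ≡ proc G₂ v
    proc-↑ʳ v = cong (proj₂ ∘ [ label G₁ , label G₂ ]) (splitAt-↑ʳ n₁ n₂ v)

    right : List (Edge (n₁ + n₂))
    right = List.map (mapEdge (n₁ ↑ʳ_)) (edges G₂)

    right-avoids-left : ∀ r u → hasEdge r right (u ↑ˡ n₂) ≡ false
    right-avoids-left r = hasEdge-map-apart ↑ˡ≢↑ʳ r (edges G₂)

    module Left = Embedded (_↑ˡ n₂) (↑ˡ-injective n₂ _ _) (proc (G₁ ∪ᴳ G₂)) (proc G₁) proc-↑ˡ right right-avoids-left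
    module Right = Embedded (n₁ ↑ʳ_) (↑ʳ-injective n₁ _ _) (proc (G₁ ∪ᴳ G₂)) (proc G₂) proc-↑ʳ [] (λ _ _ → refl)

    profile-↑ˡ : ∀ u → profileᴳ (G₁ ∪ᴳ G₂) (u ↑ˡ n₂) ≡ profileᴳ G₁ u
    profile-↑ˡ = Left.profile-map-++ (edges G₁)

    profile-↑ʳ : ∀ v → profileᴳ (G₁ ∪ᴳ G₂) (n₁ ↑ʳ v) ≡ profileᴳ G₂ v
    profile-↑ʳ v = profile-cong (proc (G₁ ∪ᴳ G₂)) (edges (G₁ ∪ᴳ G₂)) (n₁ ↑ʳ v) (proc G₂) (edges G₂) v (proc-↑ʳ v)
      λ r → trans (any-++ _ (List.map (mapEdge (_↑ˡ n₂)) (edges G₁)) right)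
                  (cong₂ _∨_ (hasEdge-map-apart (λ a b → ≢-sym (↑ˡ≢↑ʳ b a)) r (edges G₁) v)
                             (hasEdge-map (↑ʳ-injective n₁ _ _) r (edges G₂) v))

    good-∪ : goodᴳ (G₁ ∪ᴳ G₂) ≡ goodᴳ G₁ ∧ goodᴳ G₂
    good-∪ = trans (Left.good-map-++ (edges G₁)) (cong (goodᴳ G₁ ∧_) (begin
      good (proc (G₁ ∪ᴳ G₂)) right          ≡⟨ cong (good _) (sym (++-identityʳ right)) ⟩
      good (proc (G₁ ∪ᴳ G₂)) (right ++ [])  ≡⟨ Right.good-map-++ (edges G₂) ⟩
      goodᴳ G₂ ∧ true                       ≡⟨ ∧-identityʳ _ ⟩
      goodᴳ G₂                              ∎))
      where open ≡-Reasoning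

  State : Set
  State = Vec (Maybe Profile) k

  abstraction : ColGraph → State
  abstraction (G , χ) = Vec.tabulate (Maybe.map (profileᴳ G) ∘ χ)

  summary : ColGraph → Maybe State
  summary (G , χ) = when (goodᴳ G) (abstraction (G , χ))

  lookup-abstraction : ∀ G (χ : Colouring G) {i x} → χ i ≡ x →
    Vec.lookup (abstraction (G , χ)) i ≡ Maybe.map (profileᴳ G) x
  lookup-abstraction G χ {i} refl = lookup∘tabulate _ i

  abstraction-≗ : ∀ G {χ χ′ : Colouring G} → χ ≗ χ′ → abstraction (G , χ) ≡ abstraction (G , χ′)
  abstraction-≗ G χ≗χ′ = tabulate-cong (cong (Maybe.map (profileᴳ G)) ∘ χ≗χ′)

  Disjoint-abstraction⇔ : ∀ (c₁ c₂ : ColGraph) →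
    Disjoint (Vec.lookup (abstraction c₁)) (Vec.lookup (abstraction c₂)) ⇔ Disjoint (proj₂ c₁) (proj₂ c₂)
  Disjoint-abstraction⇔ (G₁ , χ₁) (G₂ , χ₂) = mk⇔
    (λ D i → Data.Sum.map (to (uncoloured G₁ χ₁ i)) (to (uncoloured G₂ χ₂ i)) (D i))
    (λ D i → Data.Sum.map (from (uncoloured G₁ χ₁ i)) (from (uncoloured G₂ χ₂ i)) (D i))
    where
    open Equivalence
    uncoloured : ∀ G (χ : Colouring G) i →
      (Vec.lookup (abstraction (G , χ)) i ≡ nothing) ⇔ (χ i ≡ nothing)
    uncoloured G χ i rewrite lookup-abstraction G χ {i} refl = map≡nothing⇔

  isolated : Fin np → Profile
  isolated p = p , false , false , false

  vertexState : Fin k → Fin np → State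
  vertexState i p = Vec.tabulate λ j → if j == i then just (isolated p) else nothing

  summary-vtx : ∀ i a p → summary ⟦ vtx i a p ⟧ ≡ just (vertexState i p)
  summary-vtx i a p = cong just (tabulate-cong colour)
    where
    colour : ∀ j → Maybe.map (profileᴳ (proj₁ ⟦ vtx i a p ⟧)) (proj₂ ⟦ vtx i a p ⟧ j)
                   ≡ (if j == i then just (isolated p) else nothing)
    colour j with j ≟ i
    ... | yes _ = refl
    ... | no _ = refl

  forgetState : Fin k → State → State
  forgetState i s = Vec.tabulate (forgetColour i (Vec.lookup s))

  colour-forget : ∀ i τ → proj₂ ⟦ forget i τ ⟧ ≗ forgetColour i (proj₂ ⟦ τ ⟧)
  colour-forget i τ j with j ≟ i
  ... | yes _ = refl
  ... | no _ = refl

  summary-forget : ∀ i τ → summary ⟦ forget i τ ⟧ ≡ Maybe.map (forgetState i) (summary ⟦ τ ⟧)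
  summary-forget i τ = begin
    when (goodᴳ G) (abstraction ⟦ forget i τ ⟧)
      ≡⟨ cong (when (goodᴳ G)) (trans (abstraction-≗ G (colour-forget i τ)) (tabulate-cong forgotten)) ⟩
    when (goodᴳ G) (forgetState i (abstraction ⟦ τ ⟧))
      ≡⟨ sym (map-when (forgetState i) (goodᴳ G) _) ⟩
    Maybe.map (forgetState i) (summary ⟦ τ ⟧) ∎
    where
    open ≡-Reasoning
    G : Graph
    G = proj₁ ⟦ τ ⟧
    χ : Colouring G
    χ = proj₂ ⟦ τ ⟧
    forgotten : ∀ j → Maybe.map (profileᴳ G) (forgetColour i χ j) ≡ forgetColour i (Vec.lookup (abstraction ⟦ τ ⟧)) j
    forgotten j with j ≟ i
    ... | yes _ = refl
    ... | no _ = sym (lookup-abstraction G χ refl)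

  addIncidence : EdgeLabel nd → Bool → Bool → Profile → Profile
  addIncidence γ isSource isTarget (p , out , in′ , dat) =
    p , incidence procOut γ isSource isTarget ∨ out
      , incidence procIn γ isSource isTarget ∨ in′
      , incidence dataEnd γ isSource isTarget ∨ dat

  addIncidences : EdgeLabel nd → Fin k → Fin k → State → State
  addIncidences γ i j s = Vec.tabulate λ l → Maybe.map (addIncidence γ (l == i) (l == j)) (Vec.lookup s l)

  addEdge : EdgeLabel nd → Fin k → Fin k → State → Maybe State
  addEdge γ i j s with Vec.lookup s i | Vec.lookup s j
  ... | just P | just Q = when (compatible γ P Q) (addIncidences γ i j s)
  ... | _ | _ = just s

  addEdge-nothingˡ : ∀ γ i j s → Vec.lookup s i ≡ nothing → addEdge γ i j s ≡ just s
  addEdge-nothingˡ γ i j s sᵢ rewrite sᵢ = refl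

  addEdge-nothingʳ : ∀ γ i j s → Vec.lookup s j ≡ nothing → addEdge γ i j s ≡ just s
  addEdge-nothingʳ γ i j s sⱼ with Vec.lookup s i
  ... | nothing = refl
  ... | just _ rewrite sⱼ = refl

  addEdge-just : ∀ γ i j s {P Q} → Vec.lookup s i ≡ just P → Vec.lookup s j ≡ just Q →
    addEdge γ i j s ≡ when (compatible γ P Q) (addIncidences γ i j s)
  addEdge-just γ i j s sᵢ sⱼ rewrite sᵢ | sⱼ = refl

  link : ∀ {n} → EdgeLabel nd → Maybe (Fin n) → Maybe (Fin n) → List (Edge n) → List (Edge n)
  link γ (just u) (just v) es = (u , γ , v) ∷ es
  link γ _ _ es = es

  addEdgeᶜ : EdgeLabel nd → Fin k → Fin k → ColGraph → ColGraph
  addEdgeᶜ γ i j (G , χ) = record G { edges = link γ (χ i) (χ j) (edges G) } , χ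

  ⟦add⟧ : ∀ γ i j τ → ⟦ add γ i j τ ⟧ ≡ addEdgeᶜ γ i j ⟦ τ ⟧
  ⟦add⟧ γ i j τ with proj₂ ⟦ τ ⟧ i | proj₂ ⟦ τ ⟧ j
  ... | just _ | just _ = refl
  ... | just _ | nothing = refl
  ... | nothing | _ = refl

  summary-addEdge : ∀ γ i j c → InjectiveColouring (proj₂ c) →
    summary (addEdgeᶜ γ i j c) ≡ (summary c >>= addEdge γ i j)
  summary-addEdge γ i j (G , χ) χ-inj with χ i in χi | χ j in χj
  ... | nothing | _ =
    sym (when->>=-just (goodᴳ G) (addEdge-nothingˡ γ i j (abstraction (G , χ)) (lookup-abstraction G χ χi)))
  ... | just _ | nothing =
    sym (when->>=-just (goodᴳ G) (addEdge-nothingʳ γ i j (abstraction (G , χ)) (lookup-abstraction G χ χj)))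
  ... | just u | just v =
    sym (when->>=-when uv-compatible (goodᴳ G)
      (trans (addEdge-just γ i j (abstraction (G , χ)) (lookup-abstraction G χ χi) (lookup-abstraction G χ χj))
             (cong (when uv-compatible) (tabulate-cong linked))))
    where
    G′ : Graph
    G′ = record G { edges = (u , γ , v) ∷ edges G }
    uv-compatible : Bool
    uv-compatible = compatible γ (profileᴳ G u) (profileᴳ G v)
    linked : ∀ l → Maybe.map (addIncidence γ (l == i) (l == j)) (Vec.lookup (abstraction (G , χ)) l)
                   ≡ Maybe.map (profileᴳ G′) (χ l)
    linked l rewrite lookup-abstraction G χ {l} refl with χ l in χl
    ... | nothing = refl
    ... | just w =
      cong just (cong₂ (λ a b → addIncidence γ a b (profileᴳ G w)) (==-colour χ-inj χl χi) (==-colour χ-inj χl χj))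

  colour-⊕ : ∀ τ σ → proj₂ ⟦ τ ⊕ σ ⟧ ≗ joinColours (proj₂ ⟦ τ ⟧) (proj₂ ⟦ σ ⟧)
  colour-⊕ τ σ i with proj₂ ⟦ τ ⟧ i
  ... | just _ = refl
  ... | nothing = refl

  joinStates : State → State → State
  joinStates s₁ s₂ = Vec.tabulate λ i → Vec.lookup s₁ i <∣> Vec.lookup s₂ i

  abstraction-∪ : ∀ G₁ G₂ (χ₁ : Colouring G₁) (χ₂ : Colouring G₂) →
    abstraction (G₁ ∪ᴳ G₂ , joinColours χ₁ χ₂) ≡ joinStates (abstraction (G₁ , χ₁)) (abstraction (G₂ , χ₂))
  abstraction-∪ G₁ G₂ χ₁ χ₂ = tabulate-cong joined
    where
    joined : ∀ i → Maybe.map (profileᴳ (G₁ ∪ᴳ G₂)) (joinColours χ₁ χ₂ i) ≡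
                   Vec.lookup (abstraction (G₁ , χ₁)) i <∣> Vec.lookup (abstraction (G₂ , χ₂)) i
    joined i rewrite lookup-abstraction G₁ χ₁ {i} refl | lookup-abstraction G₂ χ₂ {i} refl with χ₁ i | χ₂ i
    ... | just u | _ = cong just (profile-↑ˡ G₁ G₂ u)
    ... | nothing | just v = cong just (profile-↑ʳ G₁ G₂ v)
    ... | nothing | nothing = refl

  disjoint? : (s₁ s₂ : State) → Dec (Disjoint (Vec.lookup s₁) (Vec.lookup s₂))
  disjoint? s₁ s₂ = all? λ i → nothing? (Vec.lookup s₁ i) ⊎-dec nothing? (Vec.lookup s₂ i)

  plusStep : Maybe State → Maybe State → Maybe State
  plusStep (just s₁) (just s₂) = when (does (disjoint? s₁ s₂)) (joinStates s₁ s₂)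
  plusStep _ _ = nothing

  plusStep-when : ∀ a b s₁ s₂ → Disjoint (Vec.lookup s₁) (Vec.lookup s₂) →
    plusStep (when a s₁) (when b s₂) ≡ when (a ∧ b) (joinStates s₁ s₂)
  plusStep-when true true s₁ s₂ D rewrite dec-true (disjoint? s₁ s₂) D = refl
  plusStep-when true false _ _ _ = refl
  plusStep-when false _ _ _ _ = refl

  plusStep≡just⇒ : ∀ x₁ x₂ {s} → plusStep x₁ x₂ ≡ just s →
    ∃[ s₁ ] ∃[ s₂ ] x₁ ≡ just s₁ × x₂ ≡ just s₂ × Disjoint (Vec.lookup s₁) (Vec.lookup s₂)
  plusStep≡just⇒ (just s₁) (just s₂) eq =
    s₁ , s₂ , refl , refl , does-true (disjoint? s₁ s₂) (proj₁ (when≡just⇒ _ eq))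

  summary-⊕ : ∀ τ σ → Disjoint (proj₂ ⟦ τ ⟧) (proj₂ ⟦ σ ⟧) →
    summary ⟦ τ ⊕ σ ⟧ ≡ plusStep (summary ⟦ τ ⟧) (summary ⟦ σ ⟧)
  summary-⊕ τ σ D = begin
    when (goodᴳ (G₁ ∪ᴳ G₂)) (abstraction ⟦ τ ⊕ σ ⟧)
      ≡⟨ cong₂ when (good-∪ G₁ G₂) (trans (abstraction-≗ (G₁ ∪ᴳ G₂) (colour-⊕ τ σ)) (abstraction-∪ G₁ G₂ χ₁ χ₂)) ⟩
    when (goodᴳ G₁ ∧ goodᴳ G₂) (joinStates (abstraction ⟦ τ ⟧) (abstraction ⟦ σ ⟧))
      ≡⟨ sym (plusStep-when (goodᴳ G₁) (goodᴳ G₂) _ _ (Equivalence.from (Disjoint-abstraction⇔ ⟦ τ ⟧ ⟦ σ ⟧) D)) ⟩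
    plusStep (summary ⟦ τ ⟧) (summary ⟦ σ ⟧) ∎
    where
    open ≡-Reasoning
    G₁ G₂ : Graph
    G₁ = proj₁ ⟦ τ ⟧
    G₂ = proj₁ ⟦ σ ⟧
    χ₁ : Colouring G₁
    χ₁ = proj₂ ⟦ τ ⟧
    χ₂ : Colouring G₂
    χ₂ = proj₂ ⟦ σ ⟧

  leafStep : Sym np nd ns k → Maybe State
  leafStep (vertexSym i _ p) = just (vertexState i p)
  leafStep _ = nothing

  unaryStep : Sym np nd ns k → Maybe State → Maybe State
  unaryStep (addSym γ i j) x = x >>= addEdge γ i j
  unaryStep (forgetSym i) x = Maybe.map (forgetState i) x
  unaryStep _ _ = nothing

  binaryStep : Sym np nd ns k → Maybe State → Maybe State → Maybe State
  binaryStep plusSym = plusStep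
  binaryStep _ _ _ = nothing

  automaton : DBUTAOn (Sym np nd ns k) (Maybe State)
  automaton = record { δ₀ = leafStep ; δ₁ = unaryStep ; δ₂ = binaryStep ; final = is-just }

  colouring-injective : ∀ τ → Valid τ → InjectiveColouring (proj₂ ⟦ τ ⟧)
  colouring-injective (vtx i _ _) _ {a} {b} χa χb with a ≟ i | b ≟ i | χa | χb
  ... | yes a≡i | yes b≡i | _ | _ = trans a≡i (sym b≡i)
  ... | no _ | _ | () | _
  ... | yes _ | no _ | _ | ()
  colouring-injective (add γ i j τ) v =
    subst (InjectiveColouring ∘ proj₂) (sym (⟦add⟧ γ i j τ)) (colouring-injective τ v)
  colouring-injective (forget i τ) v =
    InjectiveColouring-≗ (colour-forget i τ) (forgetColour-injective i (colouring-injective τ v))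
  colouring-injective (τ ⊕ σ) (vτ , vσ , _) =
    InjectiveColouring-≗ (colour-⊕ τ σ)
      (joinColours-injective (colouring-injective τ vτ) (colouring-injective σ vσ))

  run-toTree : ∀ τ → Valid τ → runOn automaton (toTree τ) ≡ summary ⟦ τ ⟧
  run-toTree (vtx i a p) _ = sym (summary-vtx i a p)
  run-toTree (add γ i j τ) v = begin
    (runOn automaton (toTree τ) >>= addEdge γ i j)  ≡⟨ cong (_>>= addEdge γ i j) (run-toTree τ v) ⟩
    (summary ⟦ τ ⟧ >>= addEdge γ i j)               ≡⟨ sym (summary-addEdge γ i j ⟦ τ ⟧ (colouring-injective τ v)) ⟩
    summary (addEdgeᶜ γ i j ⟦ τ ⟧)                  ≡⟨ cong summary (sym (⟦add⟧ γ i j τ)) ⟩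
    summary ⟦ add γ i j τ ⟧                         ∎
    where open ≡-Reasoning
  run-toTree (forget i τ) v =
    trans (cong (Maybe.map (forgetState i)) (run-toTree τ v)) (sym (summary-forget i τ))
  run-toTree (τ ⊕ σ) (vτ , vσ , D) =
    trans (cong₂ plusStep (run-toTree τ vτ) (run-toTree σ vσ)) (sym (summary-⊕ τ σ D))

  run≡just⇒summary : ∀ {t s} τ → toTree τ ≡ t → Valid τ → runOn automaton t ≡ just s →
    goodᴳ (proj₁ ⟦ τ ⟧) ≡ true × abstraction ⟦ τ ⟧ ≡ s
  run≡just⇒summary τ refl v run≡s = when≡just⇒ _ (trans (sym (run-toTree τ v)) run≡s)

  run≡just⇒term : ∀ t {s} → runOn automaton t ≡ just s → Σ STT λ τ → toTree τ ≡ t × Valid τ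
  run≡just⇒term (leaf (vertexSym i a p)) _ = vtx i a p , refl , tt
  run≡just⇒term (unary (addSym γ i j) t) eq =
    let (τ , τ↦t , v) = run≡just⇒term t (proj₂ (>>=≡just⇒ (runOn automaton t) eq))
    in add γ i j τ , cong (unary (addSym γ i j)) τ↦t , v
  run≡just⇒term (unary (forgetSym i) t) eq =
    let (τ , τ↦t , v) = run≡just⇒term t (proj₂ (map≡just⇒ (runOn automaton t) eq))
    in forget i τ , cong (unary (forgetSym i)) τ↦t , v
  run≡just⇒term (binary plusSym t u) eq =
    let (s₁ , s₂ , t↦s₁ , u↦s₂ , D) = plusStep≡just⇒ (runOn automaton t) (runOn automaton u) eq
        (τ , τ↦t , vτ) = run≡just⇒term t t↦s₁
        (σ , σ↦u , vσ) = run≡just⇒term u u↦s₂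
        τ↦s₁ = proj₂ (run≡just⇒summary τ τ↦t vτ t↦s₁)
        σ↦s₂ = proj₂ (run≡just⇒summary σ σ↦u vσ u↦s₂)
        D′ = subst₂ (λ s₁ s₂ → Disjoint (Vec.lookup s₁) (Vec.lookup s₂)) (sym τ↦s₁) (sym σ↦s₂) D
    in τ ⊕ σ , cong₂ (binary plusSym) τ↦t σ↦u , vτ , vσ , Equivalence.to (Disjoint-abstraction⇔ ⟦ τ ⟧ ⟦ σ ⟧) D′
  run≡just⇒term (leaf (addSym _ _ _)) ()
  run≡just⇒term (leaf (forgetSym _)) ()
  run≡just⇒term (leaf plusSym) ()
  run≡just⇒term (unary (vertexSym _ _ _) _) ()
  run≡just⇒term (unary plusSym _) ()
  run≡just⇒term (binary (vertexSym _ _ _) _ _) ()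
  run≡just⇒term (binary (addSym _ _ _) _ _) ()
  run≡just⇒term (binary (forgetSym _) _ _) ()

  acceptsOn⇔InLang : ∀ t → (acceptsOn automaton t ≡ true) ⇔ InLang t
  acceptsOn⇔InLang t = mk⇔ sound complete
    where
    sound : is-just (runOn automaton t) ≡ true → InLang t
    sound accepted =
      let (s , run≡s) = is-just⇒≡just accepted
          (τ , τ↦t , v) = run≡just⇒term t run≡s
          good-τ = proj₁ (run≡just⇒summary τ τ↦t v run≡s)
      in τ , τ↦t , v , Equivalence.from (GoodGraph⇔good (proj₁ ⟦ τ ⟧)) good-τ
    complete : InLang t → is-just (runOn automaton t) ≡ true
    complete (τ , τ↦t , v , good-τ) = subst (λ t → is-just (runOn automaton t) ≡ true) τ↦t (begin
      is-just (runOn automaton (toTree τ))  ≡⟨ cong is-just (run-toTree τ v) ⟩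
      is-just (summary ⟦ τ ⟧)               ≡⟨ is-just-when _ _ ⟩
      goodᴳ (proj₁ ⟦ τ ⟧)                   ≡⟨ Equivalence.to (GoodGraph⇔good (proj₁ ⟦ τ ⟧)) good-τ ⟩
      true                                  ∎)
      where open ≡-Reasoning

  stateCode : Maybe State ↪ Fin (ℕ.suc (ℕ.suc (np * 8) ^ k))
  stateCode = Maybe↪suc (Vec↪^ (Maybe↪suc (×↪* (↪-id (Fin np)) (×↪* Bool↪2 (×↪* Bool↪2 Bool↪2)))) k)

  edgesAutomaton : DBUTA (Sym np nd ns k)
  edgesAutomaton = encodeStates automaton stateCode

  edgesAutomaton-correct : ∀ t → (accepts edgesAutomaton t ≡ true) ⇔ InLang t
  edgesAutomaton-correct t = subst (λ b → (b ≡ true) ⇔ InLang t)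
    (sym (accepts-encodeStates automaton stateCode t)) (acceptsOn⇔InLang t)

1+8n≤16^n : ∀ n → ℕ.suc (n * 8) ≤ 16 ^ n
1+8n≤16^n ℕ.zero = ≤-refl
1+8n≤16^n (ℕ.suc n) = begin
  9 + n * 8          ≤⟨ +-mono-≤ (m≤m+n 9 7) (m≤n*m (n * 8) 16) ⟩
  16 + 16 * (n * 8)  ≡⟨ sym (*-suc 16 (n * 8)) ⟩
  16 * ℕ.suc (n * 8) ≤⟨ *-monoʳ-≤ 16 (1+8n≤16^n n) ⟩
  16 * 16 ^ n        ∎
  where open ≤-Reasoning

stateCount≤ : ∀ np k → ℕ.suc (ℕ.suc (np * 8) ^ k) ≤ 2 ^ (4 * (1 + k * np))
stateCount≤ np k = begin
  ℕ.suc (ℕ.suc (np * 8) ^ k) ≤⟨ s≤s (^-monoˡ-≤ k (1+8n≤16^n np)) ⟩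
  ℕ.suc ((16 ^ np) ^ k)      ≡⟨ cong ℕ.suc (^-*-assoc 16 np k) ⟩
  ℕ.suc (16 ^ (np * k))      ≤⟨ m<m*n (16 ^ (np * k)) 16 {{m^n≢0 16 (np * k)}} (s≤s (s≤s z≤n)) ⟩
  16 ^ (np * k) * 16         ≡⟨ *-comm (16 ^ (np * k)) 16 ⟩
  16 ^ (1 + np * k)          ≡⟨ cong (λ e → 16 ^ (1 + e)) (*-comm np k) ⟩
  16 ^ (1 + k * np)          ≡⟨ ^-*-assoc 2 4 (1 + k * np) ⟩
  2 ^ (4 * (1 + k * np))     ∎
  where open ≤-Reasoning

mainTheorem7 : ∃[ c ] ∀ (np nd ns : ℕ) (Writer Reader : Fin nd → Fin np) (k : ℕ) → 1 ≤ k →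
    Σ (DBUTA (Sym np nd ns k)) λ 𝒜 →
      (DBUTA.nStates 𝒜 ≤ 2 ^ (c * (1 + k * np))) ×
      (∀ (t : BinTree (Sym np nd ns k)) →
        (accepts 𝒜 t ≡ true) ⇔ Arch.InLang np nd ns Writer Reader k t)
mainTheorem7 = 4 , λ np nd ns Writer Reader k _ →
  let open EdgeConstraints np nd ns Writer Reader k
  in edgesAutomaton , stateCount≤ np k , edgesAutomaton-correct
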